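{- For any weak $m$-part composition $\mathbf{a}$ of $n$, $$D(\mathbf{a})+D(\mathbf{a}^{1})+\cdots+D(\mathbf{a}^{m-1})=\binom{n+m}{m-1}.$$
   Context: A lattice path uses unit steps $(0,1)$ and $(1,0)$. A weak $m$-part composition of $n$ is a tuple $\mathbf{a}=(a_0,\ldots,a_{m-1})$ of nonnegative integers summing to $n$; indices are read mod $m$. Define $f_{\mathbf{a}}(y)=a_i(y-i)+\sum_{j=0}^{i-1}a_j$ for $y\in[i,i+1]$, $0\le i<m$. A lattice point $(x,y)$ with $0\le y\le m$ is dominated by $\mathbf{a}$ if $x\ge f_{\mathbf{a}}(y)$; a path is dominated by $\mathbf{a}$ if all its lattice points are. $D(\mathbf{a})$ is the number of lattice paths from $(0,0)$ to $(n,m)$ dominated by $\mathbf{a}$. The $j$-th cyclic shift is $\mathbf{a}^{j}=(a_{ -j},a_{ -j+1},\ldots,a_{ -j+m-1})$. -}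

module Defs where

open import Data.Nat using (ℕ; zero; suc; _+_; _*_; _∸_; _≤_; _<_; NonZero)
open import Data.Nat.Properties using (_≤?_; _<?_)
open import Data.Nat.DivMod using (_mod_)
open import Data.Fin using (Fin; toℕ)
open import Data.Vec using (Vec; lookup)
open import Data.List using (List; []; _∷_; map; upTo; length; filter)
open import Data.Nat.ListAction using (sum)
open import Data.List.Relation.Unary.All using (All; all?)
open import Data.Product using (_×_; _,_; proj₁; proj₂)
open import Relation.Nullary using (Dec; yes; no)
open import Relation.Nullary.Decidable using (_×-dec_)

-- Entries of a composition a = (a_0,…,a_{m-1}), indices read mod m.
-- (m is written suc k so that m ≥ 1.)
entry : {k : ℕ} → Vec ℕ (suc k) → ℕ → ℕ
entry {k} a j = lookup a (j mod (suc k))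

prefix : {k : ℕ} → Vec ℕ (suc k) → ℕ → ℕ
prefix a i = sum (map (entry a) (upTo i))

-- f_a evaluated at an integer height y with 0 ≤ y ≤ m.  The segment index i
-- with y ∈ [i, i+1], 0 ≤ i < m, is i = y for y < m and i = m-1 for y = m;
-- then f_a(y) = a_i (y - i) + Σ_{j<i} a_j.
segment : (k y : ℕ) → ℕ
segment k y with y <? suc k
... | yes _ = y
... | no  _ = k

f : {k : ℕ} → Vec ℕ (suc k) → ℕ → ℕ
f {k} a y = entry a (segment k y) * (y ∸ segment k y) + prefix a (segment k y)

Point : Set
Point = ℕ × ℕ

Dominated : {k : ℕ} → Vec ℕ (suc k) → Point → Set
Dominated {k} a (x , y) = (y ≤ suc k) × (f a y ≤ x)

dominated? : {k : ℕ} (a : Vec ℕ (suc k)) (p : Point) → Dec (Dominated a p)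
dominated? {k} a (x , y) = (y ≤? suc k) ×-dec (f a y ≤? x)

data Step : Set where
  E N : Step

paths : ℕ → ℕ → List (List Step)
paths zero    zero    = [] ∷ []
paths zero    (suc y) = map (N ∷_) (paths zero y)
paths (suc x) zero    = map (E ∷_) (paths x zero)
paths (suc x) (suc y) = map (E ∷_) (paths x (suc y)) Data.List.++ map (N ∷_) (paths (suc x) y)

pointsFrom : Point → List Step → List Point
pointsFrom p []           = p ∷ []
pointsFrom (x , y) (E ∷ s) = (x , y) ∷ pointsFrom (suc x , y) s
pointsFrom (x , y) (N ∷ s) = (x , y) ∷ pointsFrom (x , suc y) s

points : List Step → List Point
points = pointsFrom (0 , 0)

D : {k : ℕ} → (n : ℕ) → Vec ℕ (suc k) → ℕ
D {k} n a = length (filter (λ s → all? (dominated? a) (points s)) (paths n (suc k)))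

-- j-th cyclic shift a^j = (a_{-j}, a_{-j+1}, …, a_{-j+m-1}), i.e. (a^j)_i = a_{i-j mod m}
-- (for 0 ≤ j < m, i - j ≡ i + (m - j) mod m).
shift : {k : ℕ} → ℕ → Vec ℕ (suc k) → Vec ℕ (suc k)
shift {k} j a = Data.Vec.tabulate (λ i → entry a (toℕ i + (suc k ∸ j)))

-- With S(y) = a₀ + … + a_{y-1} (indices mod m), S is monotone, S(m+y) = n + S(y),
-- and f_a(y) = S(y) at integer heights, so D(a) counts the paths to (n,m) whose
-- point at height y lies in a column ≥ S(y).  We count algebraically with
-- Above x L e: paths from column x with e east steps whose successive north
-- steps obey the column bounds L.  After finite-sum arithmetic and the basic
-- identities of Above (translation, free bounds, forced steps, splitting), the
-- key fact is the last-touch decomposition: a path either stays strictly right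
-- of all its bounds or has a last north step taken exactly on its bound.
-- Applied to the free count C(n+m, m-1) and grouped by the row of the last
-- touch, cutting at the touch and rotating turns the pieces into
-- Σ_{u=1}^{m} Above (S u) [S(u+1), …, S(u+m)] n  for every such S (CyclicSum).
-- Finally D(a^j) is the summand u = m - j, since the partial sums of a^j are
-- those of a read from position m - j (Composition); the theorem comes last.
module Submission where

open import Defs
open import Data.Nat using (ℕ; zero; suc; _+_; _*_; _∸_; _≤_; _<_; z≤n; s≤s)
open import Data.Nat.Properties
open import Data.Nat.DivMod using (_mod_; _%_; m≤n⇒m%n≡m; [m+n]%n≡m%n)
open import Data.Nat.Combinatorics using (_C_; nCk+nC[k+1]≡[n+1]C[k+1]; nCn≡1; nCk≡nC[n∸k])
open import Data.Nat.Tactic.RingSolver using (solve-∀)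
open import Data.Nat.ListAction using (sum)
open import Data.Nat.ListAction.Properties using (sum-++)
open import Data.Fin using (Fin; toℕ)
import Data.Fin as Fin
open import Data.Fin.Properties using (toℕ-injective; toℕ-fromℕ<; toℕ<n)
open import Data.Vec using (Vec; lookup)
import Data.Vec as Vec
open import Data.Vec.Properties using (lookup∘tabulate)
open import Data.List using (List; []; _∷_; _++_; map; replicate; length; upTo; filter)
open import Data.List.Properties using (map-++; length-++; filter-++; filter-≐; upTo-∷ʳ; filter-none; filter-accept)
open import Data.List.Relation.Unary.All using (All; all?; []; _∷_; universal)
import Data.List.Relation.Unary.All as All
open import Data.Product using (_,_; proj₂)
open import Data.Sum using (inj₁; inj₂)
open import Data.Unit using (⊤; tt)
open import Data.Bool using (true; false)
open import Data.Empty using (⊥-elim)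
open import Relation.Nullary using (yes; no; does; ¬_)
open import Relation.Unary using (Pred; Decidable)
open import Relation.Binary.Definitions using (tri<; tri≈; tri>)
open import Relation.Binary.PropositionalEquality
open import Level using (0ℓ)
open ≡-Reasoning

Σ< : ℕ → (ℕ → ℕ) → ℕ
Σ< zero    g = 0
Σ< (suc n) g = Σ< n g + g n

sum-upTo≡Σ : ∀ (g : ℕ → ℕ) n → sum (map g (upTo n)) ≡ Σ< n g
sum-upTo≡Σ g zero    = refl
sum-upTo≡Σ g (suc n) = begin
  sum (map g (upTo (suc n)))          ≡⟨ cong (λ z → sum (map g z)) (sym (upTo-∷ʳ n)) ⟩
  sum (map g (upTo n ++ n ∷ []))      ≡⟨ cong sum (map-++ g (upTo n) (n ∷ [])) ⟩
  sum (map g (upTo n) ++ g n ∷ [])    ≡⟨ sum-++ (map g (upTo n)) (g n ∷ []) ⟩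
  sum (map g (upTo n)) + (g n + 0)    ≡⟨ cong₂ _+_ (sum-upTo≡Σ g n) (+-identityʳ (g n)) ⟩
  Σ< n g + g n                        ∎

Σ-head : ∀ n g → Σ< (suc n) g ≡ g 0 + Σ< n (λ i → g (suc i))
Σ-head zero    g = sym (+-identityʳ (g 0))
Σ-head (suc n) g = begin
  Σ< (suc n) g + g (suc n)                        ≡⟨ cong (_+ g (suc n)) (Σ-head n g) ⟩
  g 0 + Σ< n (λ i → g (suc i)) + g (suc n)        ≡⟨ +-assoc (g 0) _ (g (suc n)) ⟩
  g 0 + (Σ< n (λ i → g (suc i)) + g (suc n))      ∎

Σ-cong : ∀ n {g h} → (∀ i → i < n → g i ≡ h i) → Σ< n g ≡ Σ< n h
Σ-cong zero    eq = refl
Σ-cong (suc n) eq = cong₂ _+_ (Σ-cong n (λ i p → eq i (m≤n⇒m≤1+n p))) (eq n ≤-refl)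

Σ-ext : ∀ n {g h : ℕ → ℕ} → (∀ i → g i ≡ h i) → Σ< n g ≡ Σ< n h
Σ-ext n eq = Σ-cong n (λ i _ → eq i)

Σ-+ : ∀ n g h → Σ< n (λ i → g i + h i) ≡ Σ< n g + Σ< n h
Σ-+ zero    g h = refl
Σ-+ (suc n) g h = trans (cong (_+ (g n + h n)) (Σ-+ n g h)) (swap (Σ< n g) (Σ< n h) (g n) (h n))
  where swap : ∀ a b c d → a + b + (c + d) ≡ a + c + (b + d)
        swap = solve-∀

Σ-* : ∀ n c g → Σ< n (λ i → c * g i) ≡ c * Σ< n g
Σ-* zero    c g = sym (*-zeroʳ c)
Σ-* (suc n) c g = trans (cong (_+ c * g n) (Σ-* n c g)) (sym (*-distribˡ-+ c (Σ< n g) (g n)))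

Σ-zero : ∀ n → Σ< n (λ _ → 0) ≡ 0
Σ-zero zero    = refl
Σ-zero (suc n) = trans (+-identityʳ _) (Σ-zero n)

Σ-split : ∀ a b g → Σ< (a + b) g ≡ Σ< a g + Σ< b (λ i → g (a + i))
Σ-split a zero    g = trans (cong (λ z → Σ< z g) (+-identityʳ a)) (sym (+-identityʳ _))
Σ-split a (suc b) g = begin
  Σ< (a + suc b) g                                ≡⟨ cong (λ z → Σ< z g) (+-suc a b) ⟩
  Σ< (a + b) g + g (a + b)                        ≡⟨ cong (_+ g (a + b)) (Σ-split a b g) ⟩
  Σ< a g + Σ< b (λ i → g (a + i)) + g (a + b)     ≡⟨ +-assoc (Σ< a g) _ (g (a + b)) ⟩
  Σ< a g + Σ< (suc b) (λ i → g (a + i))           ∎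

Σ-reverse : ∀ M (g : ℕ → ℕ) → Σ< M (λ j → g (M ∸ j)) ≡ Σ< M (λ u → g (suc u))
Σ-reverse zero    g = refl
Σ-reverse (suc M) g = begin
  Σ< (suc M) (λ j → g (suc M ∸ j))       ≡⟨ Σ-head M (λ j → g (suc M ∸ j)) ⟩
  g (suc M) + Σ< M (λ j → g (M ∸ j))     ≡⟨ cong (g (suc M) +_) (Σ-reverse M g) ⟩
  g (suc M) + Σ< M (λ u → g (suc u))     ≡⟨ +-comm (g (suc M)) _ ⟩
  Σ< (suc M) (λ u → g (suc u))           ∎

-- The Iverson bracket ι l x = [l ≤ x]
-- (abstract, so that it is only ever evaluated through ι-yes and ι-no)

abstract
  ι : ℕ → ℕ → ℕ
  ι l x with l ≤? x
  ... | yes _ = 1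
  ... | no  _ = 0

  ι-yes : ∀ {l x} → l ≤ x → ι l x ≡ 1
  ι-yes {l} {x} p with l ≤? x
  ... | yes _ = refl
  ... | no ¬p = ⊥-elim (¬p p)

  ι-no : ∀ {l x} → x < l → ι l x ≡ 0
  ι-no {l} {x} p with l ≤? x
  ... | yes q = ⊥-elim (<⇒≱ p q)
  ... | no  _ = refl

ι-shift : ∀ c l x → ι (c + l) (c + x) ≡ ι l x
ι-shift c l x with l ≤? x
... | yes p = trans (ι-yes (+-monoʳ-≤ c p)) (sym (ι-yes p))
... | no ¬p = trans (ι-no (+-monoʳ-< c (≰⇒> ¬p))) (sym (ι-no (≰⇒> ¬p)))

Σ-truncate : ∀ d l (F : ℕ → ℕ) → Σ< (suc (d + l)) (λ t → ι t l * F t) ≡ Σ< (suc l) F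
Σ-truncate d l F = begin
  Σ< (suc (d + l)) g                                   ≡⟨ cong (λ z → Σ< (suc z) g) (+-comm d l) ⟩
  Σ< (suc l + d) g                                     ≡⟨ Σ-split (suc l) d g ⟩
  Σ< (suc l) g + Σ< d (λ i → g (suc l + i))            ≡⟨ cong₂ _+_ kept dropped ⟩
  Σ< (suc l) F + 0                                     ≡⟨ +-identityʳ _ ⟩
  Σ< (suc l) F                                         ∎
  where
  g = λ t → ι t l * F t
  kept : Σ< (suc l) g ≡ Σ< (suc l) F
  kept = Σ-cong (suc l) (λ t p → trans (cong (_* F t) (ι-yes (≤-pred p))) (*-identityˡ (F t)))
  dropped : Σ< d (λ i → g (suc l + i)) ≡ 0
  dropped = trans (Σ-ext d (λ i → cong (_* F (suc l + i)) (ι-no (s≤s (m≤m+n l i))))) (Σ-zero d)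

Σ-tail : ∀ c l (F : ℕ → ℕ) → Σ< (suc (c + l)) (λ i → ι (c + l) (i + l) * F i) ≡ Σ< (suc l) (λ t → F (c + t))
Σ-tail c l F = begin
  Σ< (suc (c + l)) g                               ≡⟨ cong (λ z → Σ< z g) (sym (+-suc c l)) ⟩
  Σ< (c + suc l) g                                 ≡⟨ Σ-split c (suc l) g ⟩
  Σ< c g + Σ< (suc l) (λ t → g (c + t))            ≡⟨ cong₂ _+_ dropped kept ⟩
  0 + Σ< (suc l) (λ t → F (c + t))                 ∎
  where
  g = λ i → ι (c + l) (i + l) * F i
  dropped : Σ< c g ≡ 0
  dropped = trans (Σ-cong c (λ i p → cong (_* F i) (ι-no (+-monoˡ-< l p)))) (Σ-zero c)
  kept : Σ< (suc l) (λ t → g (c + t)) ≡ Σ< (suc l) (λ t → F (c + t))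
  kept = Σ-ext (suc l) (λ t → trans (cong (_* F (c + t)) (ι-yes (+-monoˡ-≤ l (m≤m+n c t)))) (*-identityˡ _))

-- Paths above a list of column bounds

-- Above x L e counts the lattice paths that start in column x, make e east
-- steps and one north step per entry of L, where the i-th north step may only
-- be taken from a column ≥ Lᵢ; east steps left after the last north step are free.
Above : ℕ → List ℕ → ℕ → ℕ
Above x []      e       = 1
Above x (l ∷ L) zero    = ι l x * Above x L zero
Above x (l ∷ L) (suc e) = Above (suc x) (l ∷ L) e + ι l x * Above x L (suc e)

Above-translate : ∀ c x L e → Above (c + x) (map (c +_) L) e ≡ Above x L e
Above-translate c x []      e       = refl
Above-translate c x (l ∷ L) zero    = cong₂ _*_ (ι-shift c l x) (Above-translate c x L zero)
Above-translate c x (l ∷ L) (suc e) = cong₂ _+_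
  (trans (cong (λ z → Above z (map (c +_) (l ∷ L)) e) (sym (+-suc c x))) (Above-translate c (suc x) (l ∷ L) e))
  (cong₂ _*_ (ι-shift c l x) (Above-translate c x L (suc e)))

Above-translate-suc : ∀ x L e → Above (suc x) (map suc L) e ≡ Above x L e
Above-translate-suc x L e = trans (cong (λ z → Above (suc x) z e) (map-suc L)) (Above-translate 1 x L e)
  where map-suc : ∀ L → map suc L ≡ map (1 +_) L
        map-suc []      = refl
        map-suc (l ∷ L) = cong (suc l ∷_) (map-suc L)

Above-free : ∀ x k e → Above x (replicate k 0) e ≡ (e + k) C k
Above-free x zero    e       = sym (trans (cong (_C 0) (+-identityʳ e)) (trans (nCk≡nC[n∸k] {0} {e} z≤n) (nCn≡1 e)))
Above-free x (suc k) zero    = begin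
  ι 0 x * Above x (replicate k 0) zero    ≡⟨ cong (_* Above x (replicate k 0) zero) (ι-yes (z≤n {x})) ⟩
  Above x (replicate k 0) zero + 0        ≡⟨ +-identityʳ _ ⟩
  Above x (replicate k 0) zero            ≡⟨ Above-free x k zero ⟩
  k C k                                   ≡⟨ trans (nCn≡1 k) (sym (nCn≡1 (suc k))) ⟩
  suc k C suc k                           ∎
Above-free x (suc k) (suc e) = begin
  Above (suc x) (replicate (suc k) 0) e + ι 0 x * Above x (replicate k 0) (suc e)
    ≡⟨ cong₂ _+_ (Above-free (suc x) (suc k) e) (trans (cong (_* Above x (replicate k 0) (suc e)) (ι-yes (z≤n {x})))
                                                 (trans (+-identityʳ _) (Above-free x k (suc e)))) ⟩
  (e + suc k) C suc k + (suc e + k) C k   ≡⟨ cong (λ z → z C suc k + (suc e + k) C k) (+-suc e k) ⟩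
  (suc e + k) C suc k + (suc e + k) C k   ≡⟨ +-comm _ ((suc e + k) C k) ⟩
  (suc e + k) C k + (suc e + k) C suc k   ≡⟨ nCk+nC[k+1]≡[n+1]C[k+1] (suc e + k) k ⟩
  suc (suc e + k) C suc k                 ≡⟨ cong (_C suc k) (sym (+-suc (suc e) k)) ⟩
  (suc e + suc k) C suc k                 ∎

Above-vacuous : ∀ x L e → All (_≤ x) L → Above x L e ≡ Above x (replicate (length L) 0) e
Above-vacuous x []      e       []       = refl
Above-vacuous x (l ∷ L) zero    (p ∷ ps) =
  cong₂ _*_ (trans (ι-yes p) (sym (ι-yes (z≤n {x})))) (Above-vacuous x L zero ps)
Above-vacuous x (l ∷ L) (suc e) (p ∷ ps) = cong₂ _+_
  (Above-vacuous (suc x) (l ∷ L) e (All.map m≤n⇒m≤1+n (p ∷ ps)))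
  (cong₂ _*_ (trans (ι-yes p) (sym (ι-yes (z≤n {x})))) (Above-vacuous x L (suc e) ps))

-- A final bound equal to the end column forces the last north step to be the
-- last step of the path, so it adds nothing to the count.
Above-forcedLast : ∀ x L e b → b ≡ x + e → Above x (L ++ b ∷ []) e ≡ Above x L e
Above-forcedLast x []      zero    b eq = trans (*-identityʳ _) (ι-yes (≤-reflexive (trans eq (+-identityʳ x))))
Above-forcedLast x []      (suc e) b eq = cong₂ _+_
  (Above-forcedLast (suc x) [] e b (trans eq (+-suc x e)))
  (cong (_* 1) (ι-no (subst (x <_) (sym eq) (m<m+n x (s≤s z≤n)))))
Above-forcedLast x (l ∷ L) zero    b eq = cong (ι l x *_) (Above-forcedLast x L zero b eq)
Above-forcedLast x (l ∷ L) (suc e) b eq = cong₂ _+_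
  (Above-forcedLast (suc x) (l ∷ L) e b (trans eq (+-suc x e)))
  (cong (ι l x *_) (Above-forcedLast x L (suc e) b eq))

Above-single : ∀ {x l} → x ≤ l → Above x (l ∷ []) (l ∸ x) ≡ 1
Above-single {x} {l} p = Above-forcedLast x [] (l ∸ x) l (sym (m+[n∸m]≡n p))

HeadAtLeast : ℕ → List ℕ → Set
HeadAtLeast x []      = ⊤
HeadAtLeast x (r ∷ _) = x ≤ r

HeadAtLeast-zero : ∀ L → HeadAtLeast 0 L
HeadAtLeast-zero []      = tt
HeadAtLeast-zero (l ∷ L) = z≤n

-- If the first bound is ≥ x, raising every bound by one forces the path to start
-- with an east step; removing it gives a path for the original bounds.
Above-raised : ∀ x R e → HeadAtLeast x R → Above x (map suc R) (suc e) ≡ Above x R e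
Above-raised x []      e h = refl
Above-raised x (r ∷ R) e h = begin
  Above (suc x) (map suc (r ∷ R)) e + ι (suc r) x * Above x (map suc R) (suc e)
    ≡⟨ cong₂ _+_ (Above-translate-suc x (r ∷ R) e) (cong (_* Above x (map suc R) (suc e)) (ι-no (s≤s h))) ⟩
  Above x (r ∷ R) e + 0 ≡⟨ +-identityʳ _ ⟩
  Above x (r ∷ R) e     ∎

-- Splitting a path at the north step of bound l: if it is taken after i east
-- steps, the path is a path for L1 followed by one for L2 from column x + i.
splitTerm : ℕ → List ℕ → ℕ → List ℕ → ℕ → ℕ → ℕ
splitTerm x L1 l L2 e i = ι l (i + x) * (Above x L1 i * Above (i + x) L2 (e ∸ i))

Above-split : ∀ x L1 l L2 e → Above x (L1 ++ l ∷ L2) e ≡ Σ< (suc e) (splitTerm x L1 l L2 e)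
Above-split x []        l L2 zero    = cong (ι l x *_) (sym (*-identityˡ _))
Above-split x []        l L2 (suc e) = begin
  Above (suc x) (l ∷ L2) e + ι l x * Above x L2 (suc e)
    ≡⟨ cong₂ _+_ (Above-split (suc x) [] l L2 e) (cong (ι l x *_) (sym (*-identityˡ _))) ⟩
  Σ< (suc e) (splitTerm (suc x) [] l L2 e) + T 0
    ≡⟨ cong (_+ T 0) (Σ-ext (suc e) (λ i → cong (λ z → ι l z * (1 * Above z L2 (e ∸ i))) (+-suc i x))) ⟩
  Σ< (suc e) (λ i → T (suc i)) + T 0     ≡⟨ +-comm _ (T 0) ⟩
  T 0 + Σ< (suc e) (λ i → T (suc i))     ≡⟨ sym (Σ-head (suc e) T) ⟩
  Σ< (suc (suc e)) T                     ∎
  where T = splitTerm x [] l L2 (suc e)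
Above-split x (l' ∷ L1) l L2 zero    = begin
  ι l' x * Above x (L1 ++ l ∷ L2) zero               ≡⟨ cong (ι l' x *_) (Above-split x L1 l L2 zero) ⟩
  ι l' x * (0 + ι l x * (Above x L1 0 * Above x L2 0)) ≡⟨ reassoc (ι l' x) (ι l x) (Above x L1 0) (Above x L2 0) ⟩
  0 + ι l x * ((ι l' x * Above x L1 0) * Above x L2 0) ∎
  where reassoc : ∀ a b c d → a * (0 + b * (c * d)) ≡ 0 + b * ((a * c) * d)
        reassoc = solve-∀
Above-split x (l' ∷ L1) l L2 (suc e) = begin
  Above (suc x) (l' ∷ L1 ++ l ∷ L2) e + c * Above x (L1 ++ l ∷ L2) (suc e)
    ≡⟨ cong₂ _+_ (Above-split (suc x) (l' ∷ L1) l L2 e) (cong (c *_) (Above-split x L1 l L2 (suc e))) ⟩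
  Σ< (suc e) (splitTerm (suc x) (l' ∷ L1) l L2 e) + c * Σ< (suc (suc e)) B
    ≡⟨ cong₂ (λ u v → u + c * v) (Σ-ext (suc e) eastFirst) (Σ-head (suc e) B) ⟩
  Σ< (suc e) A + c * (B 0 + Σ< (suc e) (λ i → B (suc i)))
    ≡⟨ cong (λ z → Σ< (suc e) A + z) (trans (*-distribˡ-+ c (B 0) _) (cong (c * B 0 +_) (sym (Σ-* (suc e) c _)))) ⟩
  Σ< (suc e) A + (c * B 0 + Σ< (suc e) (λ i → c * B (suc i)))
    ≡⟨ regroup (Σ< (suc e) A) (c * B 0) _ ⟩
  c * B 0 + (Σ< (suc e) A + Σ< (suc e) (λ i → c * B (suc i)))
    ≡⟨ cong₂ _+_ (northFirst (ι l x) c (Above x L1 0) (Above x L2 (suc e))) (sym (Σ-+ (suc e) A _)) ⟩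
  T 0 + Σ< (suc e) (λ i → A i + c * B (suc i))
    ≡⟨ cong (T 0 +_) (Σ-ext (suc e) (λ i → merge (ι l (suc (i + x))) (Above (suc x) (l' ∷ L1) i) c
                                                   (Above x L1 (suc i)) (Above (suc (i + x)) L2 (e ∸ i)))) ⟩
  T 0 + Σ< (suc e) (λ i → T (suc i)) ≡⟨ sym (Σ-head (suc e) T) ⟩
  Σ< (suc (suc e)) T ∎
  where
  c = ι l' x
  T = splitTerm x (l' ∷ L1) l L2 (suc e)
  B = splitTerm x L1 l L2 (suc e)
  A : ℕ → ℕ
  A i = ι l (suc (i + x)) * (Above (suc x) (l' ∷ L1) i * Above (suc (i + x)) L2 (e ∸ i))
  eastFirst : ∀ i → splitTerm (suc x) (l' ∷ L1) l L2 e i ≡ A i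
  eastFirst i = cong (λ z → ι l z * (Above (suc x) (l' ∷ L1) i * Above z L2 (e ∸ i))) (+-suc i x)
  regroup : ∀ a b d → a + (b + d) ≡ b + (a + d)
  regroup = solve-∀
  northFirst : ∀ i c q r → c * (i * (q * r)) ≡ i * ((c * q) * r)
  northFirst = solve-∀
  merge : ∀ i a c b q → i * (a * q) + c * (i * (b * q)) ≡ i * ((a + c * b) * q)
  merge = solve-∀

-- The last-touch decomposition

-- Paths from column x whose last touch of the boundary is the north step with
-- bound l (which follows the bounds pre and precedes the bounds L): before it
-- the path reaches column l exactly at that step; after it the path, with
-- e + x - l east steps left, stays strictly right of the bounds L.
touchTerm : ℕ → List ℕ → ℕ → List ℕ → ℕ → ℕ
touchTerm x pre l L e =
  ι x l * (ι l (e + x) * (Above x (pre ++ l ∷ []) (l ∸ x) * Above l (map suc L) (e + x ∸ l)))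

touchSum : ℕ → List ℕ → List ℕ → ℕ → ℕ
touchSum x pre []      e = 0
touchSum x pre (l ∷ L) e = touchTerm x pre l L e + touchSum x (pre ++ l ∷ []) L e

-- touchTerm and touchSum follow the recursion of Above in their prefix: with no
-- east step left the first north step must be allowed, ...
touchTerm-cons-zero : ∀ x l0 pre l L → touchTerm x (l0 ∷ pre) l L 0 ≡ ι l0 x * touchTerm x pre l L 0
touchTerm-cons-zero x l0 pre l L with <-cmp x l
... | tri< p _ _ = begin
    ι x l * (ι l x * (Above x (l0 ∷ pre ++ l ∷ []) (l ∸ x) * K))
      ≡⟨ cong (λ z → ι x l * (z * (Above x (l0 ∷ pre ++ l ∷ []) (l ∸ x) * K))) (ι-no p) ⟩
    ι x l * 0                        ≡⟨ absorb (ι x l) (ι l0 x) ⟩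
    ι l0 x * (ι x l * 0)
      ≡⟨ cong (λ z → ι l0 x * (ι x l * (z * (Above x (pre ++ l ∷ []) (l ∸ x) * K)))) (sym (ι-no p)) ⟩
    ι l0 x * (ι x l * (ι l x * (Above x (pre ++ l ∷ []) (l ∸ x) * K))) ∎
  where K = Above l (map suc L) (x ∸ l)
        absorb : ∀ a b → a * 0 ≡ b * (a * 0)
        absorb = solve-∀
... | tri≈ _ refl _ rewrite n∸n≡0 x =
  reassoc (ι x x) (ι l0 x) (Above x (pre ++ x ∷ []) 0) (Above x (map suc L) 0)
  where reassoc : ∀ a c q k → a * (a * ((c * q) * k)) ≡ c * (a * (a * (q * k)))
        reassoc = solve-∀
... | tri> _ _ p rewrite ι-no p = sym (*-zeroʳ (ι l0 x))

touchSum-cons-zero : ∀ x l0 pre L → touchSum x (l0 ∷ pre) L 0 ≡ ι l0 x * touchSum x pre L 0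
touchSum-cons-zero x l0 pre []      = sym (*-zeroʳ (ι l0 x))
touchSum-cons-zero x l0 pre (l ∷ L) = begin
  touchTerm x (l0 ∷ pre) l L 0 + touchSum x (l0 ∷ pre ++ l ∷ []) L 0
    ≡⟨ cong₂ _+_ (touchTerm-cons-zero x l0 pre l L) (touchSum-cons-zero x l0 (pre ++ l ∷ []) L) ⟩
  ι l0 x * touchTerm x pre l L 0 + ι l0 x * touchSum x (pre ++ l ∷ []) L 0
    ≡⟨ sym (*-distribˡ-+ (ι l0 x) _ _) ⟩
  ι l0 x * (touchTerm x pre l L 0 + touchSum x (pre ++ l ∷ []) L 0) ∎

-- ... and otherwise the path begins with an east step or with the north step of bound l0.
touchTerm-cons-suc : ∀ x l0 pre l L e →
  touchTerm x (l0 ∷ pre) l L (suc e) ≡ touchTerm (suc x) (l0 ∷ pre) l L e + ι l0 x * touchTerm x pre l L (suc e)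
touchTerm-cons-suc x l0 pre l L e with <-cmp x l
... | tri< p _ _ rewrite +-∸-assoc 1 p | +-suc e x | ι-yes (<⇒≤ p) | ι-yes p =
  expand (ι l (suc (e + x))) (Above (suc x) (l0 ∷ pre ++ l ∷ []) (l ∸ suc x)) (ι l0 x)
         (Above x (pre ++ l ∷ []) (suc (l ∸ suc x))) (Above l (map suc L) (suc (e + x) ∸ l))
  where expand : ∀ I A c B K → 1 * (I * ((A + c * B) * K)) ≡ 1 * (I * (A * K)) + c * (1 * (I * (B * K)))
        expand = solve-∀
... | tri≈ _ refl _ rewrite n∸n≡0 x | ι-yes (≤-refl {x}) | ι-no (n<1+n x) =
  expand (ι x (suc (e + x))) (ι l0 x) (Above x (pre ++ x ∷ []) 0) (Above x (map suc L) (suc (e + x) ∸ x))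
         (ι x (e + suc x) * (Above (suc x) (l0 ∷ pre ++ x ∷ []) (x ∸ suc x) * Above x (map suc L) (e + suc x ∸ x)))
  where expand : ∀ I c B K Z → 1 * (I * ((c * B) * K)) ≡ 0 * Z + c * (1 * (I * (B * K)))
        expand = solve-∀
... | tri> _ _ p rewrite ι-no p | ι-no (m<n⇒m<1+n p) = sym (*-zeroʳ (ι l0 x))

touchSum-cons-suc : ∀ x l0 pre L e →
  touchSum x (l0 ∷ pre) L (suc e) ≡ touchSum (suc x) (l0 ∷ pre) L e + ι l0 x * touchSum x pre L (suc e)
touchSum-cons-suc x l0 pre []      e = sym (*-zeroʳ (ι l0 x))
touchSum-cons-suc x l0 pre (l ∷ L) e = begin
  touchTerm x (l0 ∷ pre) l L (suc e) + touchSum x (l0 ∷ pre ++ l ∷ []) L (suc e)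
    ≡⟨ cong₂ _+_ (touchTerm-cons-suc x l0 pre l L e) (touchSum-cons-suc x l0 (pre ++ l ∷ []) L e) ⟩
  (a + c * b) + (d + c * g)
    ≡⟨ regroup a b c d g ⟩
  (a + d) + c * (b + g) ∎
  where c = ι l0 x
        a = touchTerm (suc x) (l0 ∷ pre) l L e
        b = touchTerm x pre l L (suc e)
        d = touchSum (suc x) (l0 ∷ pre ++ l ∷ []) L e
        g = touchSum x (pre ++ l ∷ []) L (suc e)
        regroup : ∀ a b c d g → (a + c * b) + (d + c * g) ≡ (a + d) + c * (b + g)
        regroup = solve-∀

-- For the first bound l itself: a north step allowed by the bound l is either
-- allowed by the strict bound l + 1 or taken exactly on the bound (a touch).
touch-first-zero : ∀ x l L → ι l x * Above x (map suc L) 0 ≡ ι (suc l) x * Above x (map suc L) 0 + touchTerm x [] l L 0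
touch-first-zero x l L with <-cmp x l
... | tri< p _ _ rewrite ι-no p | ι-no (m<n⇒m<1+n p) = sym (*-zeroʳ (ι x l))
... | tri≈ _ refl _ rewrite n∸n≡0 x | ι-yes (≤-refl {x}) | ι-no (n<1+n x) = onTouch (Above x (map suc L) 0)
  where onTouch : ∀ q → 1 * q ≡ 0 * q + 1 * (1 * ((1 * 1) * q))
        onTouch = solve-∀
... | tri> _ _ p rewrite ι-no p | ι-yes (<⇒≤ p) | ι-yes p = sym (+-identityʳ _)

touch-first-suc : ∀ x l L e →
  touchTerm (suc x) [] l L e + ι l x * Above x (map suc L) (suc e) ≡ ι (suc l) x * Above x (map suc L) (suc e) + touchTerm x [] l L (suc e)
touch-first-suc x l L e with <-cmp x l
... | tri< p _ _ rewrite ι-no p | ι-no (m<n⇒m<1+n p) | ι-yes p | ι-yes (<⇒≤ p)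
                       | Above-single p | Above-single (<⇒≤ p) | +-suc e x = +-comm _ 0
... | tri≈ _ refl _ rewrite n∸n≡0 x | ι-yes (≤-refl {x}) | ι-no (n<1+n x) | ι-yes (m≤n+m x (suc e))
                          | m+n∸n≡m (suc e) x = onTouch (Above x (map suc L) (suc e))
  where onTouch : ∀ q → 1 * q ≡ 0 * q + 1 * (1 * ((1 * 1) * q))
        onTouch = solve-∀
... | tri> _ _ p rewrite ι-no p | ι-no (m<n⇒m<1+n p) | ι-yes (<⇒≤ p) | ι-yes p = +-comm 0 _

-- The last-touch decomposition: a path either stays strictly right of all its
-- bounds or has a last north step taken exactly on its bound.
Above-lastTouch : ∀ x L e → Above x L e ≡ Above x (map suc L) e + touchSum x [] L e
Above-lastTouch x []      e       = refl
Above-lastTouch x (l ∷ L) zero    = begin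
  ι l x * Above x L 0                               ≡⟨ cong (ι l x *_) (Above-lastTouch x L 0) ⟩
  ι l x * (S + touchSum x [] L 0)                   ≡⟨ *-distribˡ-+ (ι l x) S _ ⟩
  ι l x * S + ι l x * touchSum x [] L 0             ≡⟨ cong₂ _+_ (touch-first-zero x l L) (sym (touchSum-cons-zero x l [] L)) ⟩
  (ι (suc l) x * S + touchTerm x [] l L 0) + touchSum x (l ∷ []) L 0
                                                    ≡⟨ +-assoc (ι (suc l) x * S) _ _ ⟩
  ι (suc l) x * S + (touchTerm x [] l L 0 + touchSum x (l ∷ []) L 0) ∎
  where S = Above x (map suc L) 0
Above-lastTouch x (l ∷ L) (suc e) = begin
  Above (suc x) (l ∷ L) e + c * Above x L (suc e)
    ≡⟨ cong₂ _+_ (Above-lastTouch (suc x) (l ∷ L) e) (cong (c *_) (Above-lastTouch x L (suc e))) ⟩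
  (A + (J1 + T1)) + c * (S + T0)    ≡⟨ regroup₁ A J1 T1 c S T0 ⟩
  (A + T1 + c * T0) + (J1 + c * S)  ≡⟨ cong ((A + T1 + c * T0) +_) (touch-first-suc x l L e) ⟩
  (A + T1 + c * T0) + (c' * S + J2) ≡⟨ regroup₂ A T1 c T0 c' S J2 ⟩
  (A + c' * S) + (J2 + (T1 + c * T0)) ≡⟨ cong (λ z → (A + c' * S) + (J2 + z)) (sym (touchSum-cons-suc x l [] L e)) ⟩
  (A + c' * S) + (J2 + touchSum x (l ∷ []) L (suc e)) ∎
  where c  = ι l x
        c' = ι (suc l) x
        S  = Above x (map suc L) (suc e)
        A  = Above (suc x) (suc l ∷ map suc L) e
        J1 = touchTerm (suc x) [] l L e
        J2 = touchTerm x [] l L (suc e)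
        T1 = touchSum (suc x) (l ∷ []) L e
        T0 = touchSum x [] L (suc e)
        regroup₁ : ∀ A J1 T1 c S T0 → (A + (J1 + T1)) + c * (S + T0) ≡ (A + T1 + c * T0) + (J1 + c * S)
        regroup₁ = solve-∀
        regroup₂ : ∀ A T1 c T0 c' S J2 → (A + T1 + c * T0) + (c' * S + J2) ≡ (A + c' * S) + (J2 + (T1 + c * T0))
        regroup₂ = solve-∀

-- Summing a touch at bound l over all start columns t ≤ c + l (with c + l + 1
-- east steps in total) reassembles the pieces cut at the touch point in the
-- opposite order: the part after the touch, then a north step at column c + l,
-- then the part before the touch shifted right by c + l.  This is the rotation
-- behind the cyclic lemma.
touchColumn′ : ∀ c l pre R → HeadAtLeast l R →
  Σ< (suc (c + l)) (λ t → touchTerm t pre l R (suc (c + l))) ≡ Above l (R ++ (c + l) ∷ map ((c + l) +_) (pre ++ l ∷ [])) (c + l)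
touchColumn′ c l pre R h = begin
  Σ< (suc (c + l)) (λ t → touchTerm t pre l R (suc (c + l)))
    ≡⟨ Σ-ext (suc (c + l)) afterTouch ⟩
  Σ< (suc (c + l)) (λ t → ι t l * (P t * Above l R (c + t)))
    ≡⟨ Σ-truncate c l (λ t → P t * Above l R (c + t)) ⟩
  Σ< (suc l) (λ t → P t * Above l R (c + t))
    ≡⟨ Σ-ext (suc l) beforeTouch ⟩
  Σ< (suc l) (λ t → Above l R (c + t) * Above (c + t + l) (map ((c + l) +_) X) ((c + l) ∸ (c + t)))
    ≡⟨ sym (Σ-tail c l (λ i → Above l R i * Above (i + l) (map ((c + l) +_) X) ((c + l) ∸ i))) ⟩
  Σ< (suc (c + l)) (splitTerm l R (c + l) (map ((c + l) +_) X) (c + l))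
    ≡⟨ sym (Above-split l R (c + l) (map ((c + l) +_) X) (c + l)) ⟩
  Above l (R ++ (c + l) ∷ map ((c + l) +_) X) (c + l) ∎
  where
  X = pre ++ l ∷ []
  P : ℕ → ℕ
  P t = Above t X (l ∸ t)
  rearrange₁ : ∀ c l t → suc (c + l) + t ≡ suc (c + t) + l
  rearrange₁ = solve-∀
  rearrange₂ : ∀ c l t → c + t + l ≡ (c + l) + t
  rearrange₂ = solve-∀
  -- the part after the touch: drop the forced first east step of the strict bounds
  afterTouch : ∀ t → touchTerm t pre l R (suc (c + l)) ≡ ι t l * (P t * Above l R (c + t))
  afterTouch t = cong (ι t l *_) (begin
    ι l (suc (c + l) + t) * (P t * Above l (map suc R) (suc (c + l) + t ∸ l))
      ≡⟨ cong₂ _*_ (ι-yes (≤-trans (m≤n+m l c) (≤-trans (n≤1+n _) (m≤m+n (suc (c + l)) t))))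
                   (cong (λ z → P t * Above l (map suc R) (z ∸ l)) (rearrange₁ c l t)) ⟩
    1 * (P t * Above l (map suc R) (suc (c + t) + l ∸ l))
      ≡⟨ *-identityˡ _ ⟩
    P t * Above l (map suc R) (suc (c + t) + l ∸ l)
      ≡⟨ cong (λ z → P t * Above l (map suc R) z) (m+n∸n≡m (suc (c + t)) l) ⟩
    P t * Above l (map suc R) (suc (c + t))
      ≡⟨ cong (P t *_) (Above-raised l R (c + t) h) ⟩
    P t * Above l R (c + t) ∎)
  beforeTouch : ∀ t → P t * Above l R (c + t) ≡ Above l R (c + t) * Above (c + t + l) (map ((c + l) +_) X) ((c + l) ∸ (c + t))
  beforeTouch t = begin
    P t * Above l R (c + t)  ≡⟨ *-comm (P t) _ ⟩
    Above l R (c + t) * Above t X (l ∸ t)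
      ≡⟨ cong (Above l R (c + t) *_) (sym (Above-translate (c + l) t X (l ∸ t))) ⟩
    Above l R (c + t) * Above ((c + l) + t) (map ((c + l) +_) X) (l ∸ t)
      ≡⟨ cong₂ (λ a b → Above l R (c + t) * Above a (map ((c + l) +_) X) b)
               (sym (rearrange₂ c l t)) (sym ([m+n]∸[m+o]≡n∸o c l t)) ⟩
    Above l R (c + t) * Above (c + t + l) (map ((c + l) +_) X) ((c + l) ∸ (c + t)) ∎

touchColumn : ∀ n l pre R → l ≤ n → HeadAtLeast l R →
  Σ< (suc n) (λ t → touchTerm t pre l R (suc n)) ≡ Above l (R ++ n ∷ map (n +_) (pre ++ l ∷ [])) n
touchColumn n l pre R p h =
  subst (λ N → Σ< (suc N) (λ t → touchTerm t pre l R (suc N)) ≡ Above l (R ++ N ∷ map (N +_) (pre ++ l ∷ [])) N)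
        (m∸n+n≡m p) (touchColumn′ (n ∸ l) l pre R h)

slice : (ℕ → ℕ) → ℕ → ℕ → List ℕ
slice g c zero      = []
slice g c (suc len) = g c ∷ slice g (suc c) len

slice-cong : ∀ len (g g' : ℕ → ℕ) c c' → (∀ i → i < len → g (c + i) ≡ g' (c' + i)) → slice g c len ≡ slice g' c' len
slice-cong zero      g g' c c' eq = refl
slice-cong (suc len) g g' c c' eq = cong₂ _∷_
  (trans (cong g (sym (+-identityʳ c))) (trans (eq 0 (s≤s z≤n)) (cong g' (+-identityʳ c'))))
  (slice-cong len g g' (suc c) (suc c')
    (λ i p → trans (cong g (sym (+-suc c i))) (trans (eq (suc i) (s≤s p)) (cong g' (+-suc c' i)))))

slice-snoc : ∀ (g : ℕ → ℕ) c len → slice g c len ++ g (c + len) ∷ [] ≡ slice g c (suc len)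
slice-snoc g c zero      = cong (λ z → g z ∷ []) (+-identityʳ c)
slice-snoc g c (suc len) =
  cong (g c ∷_) (trans (cong (λ z → slice g (suc c) len ++ g z ∷ []) (+-suc c len)) (slice-snoc g (suc c) len))

slice-++ : ∀ (g : ℕ → ℕ) c p q → slice g c (p + q) ≡ slice g c p ++ slice g (c + p) q
slice-++ g c zero    q = cong (λ z → slice g z q) (sym (+-identityʳ c))
slice-++ g c (suc p) q =
  cong (g c ∷_) (trans (slice-++ g (suc c) p q) (cong (λ z → slice g (suc c) p ++ slice g z q) (sym (+-suc c p))))

map-slice : ∀ (h g : ℕ → ℕ) c len → map h (slice g c len) ≡ slice (λ z → h (g z)) c len
map-slice h g c zero      = refl
map-slice h g c (suc len) = cong (h (g c) ∷_) (map-slice h g (suc c) len)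

length-slice : ∀ (g : ℕ → ℕ) c len → length (slice g c len) ≡ len
length-slice g c zero      = refl
length-slice g c (suc len) = cong suc (length-slice g (suc c) len)

slice-bounded : ∀ x (g : ℕ → ℕ) c len → (∀ i → i < len → g (c + i) ≤ x) → All (_≤ x) (slice g c len)
slice-bounded x g c zero      bd = []
slice-bounded x g c (suc len) bd =
  subst (_≤ x) (cong g (+-identityʳ c)) (bd 0 (s≤s z≤n)) ∷
  slice-bounded x g (suc c) len (λ i p → subst (_≤ x) (cong g (+-suc c i)) (bd (suc i) (s≤s p)))

-- The cyclic identity for an abstract periodic boundary

-- S plays the role of the partial sums of a composition of n into m = k + 1
-- parts: monotone, with S m = n and S (m + y) = n + S y.
module CyclicSum (S : ℕ → ℕ) (n k : ℕ) (mono : ∀ y → S y ≤ S (suc y)) (Sm : S (suc k) ≡ n)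
                 (per : ∀ y → S (suc k + y) ≡ n + S y) where

  -- Paths from column S u with n east steps above the boundary S read from
  -- height u on: the summands of the cyclic sum.
  rotated : ℕ → ℕ
  rotated u = Above (S u) (slice S (suc u) (suc k)) n

  L : List ℕ
  L = slice S 1 k

  S-mono : ∀ d y → S y ≤ S (d + y)
  S-mono zero    y = ≤-refl
  S-mono (suc d) y = ≤-trans (S-mono d y) (mono (d + y))

  S≤n : ∀ y → y ≤ suc k → S y ≤ n
  S≤n y p = subst (S y ≤_) (trans (cong S (m∸n+n≡m p)) Sm) (S-mono (suc k ∸ y) y)

  slice-period : ∀ len → slice S (suc (suc k)) len ≡ map (n +_) (slice S 1 len)
  slice-period len = trans (slice-cong len S (λ z → n + S z) (suc (suc k)) 1
                             (λ i _ → trans (cong S (sym (+-suc (suc k) i))) (per (suc i))))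
                           (sym (map-slice (n +_) S 1 len))

  -- From column n every bound S y ≤ n is vacuous: the free count.
  free-count : (suc n + k) C k ≡ Above n L (suc n)
  free-count = sym (begin
    Above n L (suc n)
      ≡⟨ Above-vacuous n L (suc n) (slice-bounded n S 1 k (λ i p → S≤n (suc i) (s≤s (<⇒≤ p)))) ⟩
    Above n (replicate (length L) 0) (suc n)
      ≡⟨ cong (λ z → Above n (replicate z 0) (suc n)) (length-slice S 1 k) ⟩
    Above n (replicate k 0) (suc n) ≡⟨ Above-free n k (suc n) ⟩
    (suc n + k) C k ∎)

  strip-touches : ∀ t → Above t L (suc n) ≡ Above 0 (map suc L) (suc n) + Σ< (suc t) (λ t' → touchSum t' [] L (suc n))
  strip-touches zero    = Above-lastTouch 0 L (suc n)
  strip-touches (suc t) = begin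
    Above (suc t) L (suc n)
      ≡⟨ Above-lastTouch (suc t) L (suc n) ⟩
    Above (suc t) (map suc L) (suc n) + touchSum (suc t) [] L (suc n)
      ≡⟨ cong (_+ touchSum (suc t) [] L (suc n)) (trans (Above-translate-suc t L (suc n)) (strip-touches t)) ⟩
    Above 0 (map suc L) (suc n) + Σ< (suc t) (λ t' → touchSum t' [] L (suc n)) + touchSum (suc t) [] L (suc n)
      ≡⟨ +-assoc (Above 0 (map suc L) (suc n)) _ _ ⟩
    Above 0 (map suc L) (suc n) + Σ< (suc (suc t)) (λ t' → touchSum t' [] L (suc n)) ∎

  -- The paths that never touch are the summand u = m.
  untouched : Above 0 (map suc L) (suc n) ≡ rotated (suc k)
  untouched = begin
    Above 0 (map suc L) (suc n)             ≡⟨ Above-raised 0 L n (HeadAtLeast-zero L) ⟩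
    Above 0 L n                             ≡⟨ sym (Above-forcedLast 0 L n n refl) ⟩
    Above 0 (L ++ n ∷ []) n                 ≡⟨ cong (λ z → Above 0 (L ++ z ∷ []) n) (sym Sm) ⟩
    Above 0 (slice S 1 k ++ S (1 + k) ∷ []) n ≡⟨ cong (λ z → Above 0 z n) (slice-snoc S 1 k) ⟩
    Above 0 (slice S 1 (suc k)) n           ≡⟨ sym (Above-translate n 0 (slice S 1 (suc k)) n) ⟩
    Above (n + 0) (map (n +_) (slice S 1 (suc k))) n
      ≡⟨ cong₂ (λ a b → Above a b n) (trans (+-identityʳ n) (sym Sm)) (sym (slice-period (suc k))) ⟩
    rotated (suc k) ∎

  slice-head : ∀ u r → HeadAtLeast (S (suc u)) (slice S (suc (suc u)) r)
  slice-head u zero    = tt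
  slice-head u (suc r) = mono (suc u)

  -- The paths whose last touch is at row u + 1 form the summand u + 1: the
  -- bounds after that row, then the bounds of the next period, are exactly the
  -- boundary read from height u + 1.
  lastTouchRow : ∀ u r → u + suc r ≡ k →
    Σ< (suc n) (λ t → touchTerm t (slice S 1 u) (S (suc u)) (slice S (suc (suc u)) r) (suc n)) ≡ rotated (suc u)
  lastTouchRow u r eq = begin
    Σ< (suc n) (λ t → touchTerm t (slice S 1 u) (S (suc u)) R (suc n))
      ≡⟨ touchColumn n (S (suc u)) (slice S 1 u) R (S≤n (suc u) u<m) (slice-head u r) ⟩
    Above (S (suc u)) (R ++ n ∷ map (n +_) (slice S 1 u ++ S (suc u) ∷ [])) n
      ≡⟨ cong (λ z → Above (S (suc u)) z n) (sym rotated-bounds) ⟩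
    rotated (suc u) ∎
    where
    R = slice S (suc (suc u)) r
    u<m : suc u ≤ suc k
    u<m = subst (suc u ≤_) (cong suc eq) (s≤s (m≤m+n u (suc r)))
    length-split : suc k ≡ r + suc (suc u)
    length-split = trans (cong suc (sym eq)) (arith u r)
      where arith : ∀ u r → suc (u + suc r) ≡ r + suc (suc u)
            arith = solve-∀
    end-of-R : suc (suc u) + r ≡ suc k
    end-of-R = trans (arith u r) (cong suc eq)
      where arith : ∀ u r → suc (suc u) + r ≡ suc (u + suc r)
            arith = solve-∀
    rotated-bounds : slice S (suc (suc u)) (suc k) ≡ R ++ n ∷ map (n +_) (slice S 1 u ++ S (suc u) ∷ [])
    rotated-bounds = begin
      slice S (suc (suc u)) (suc k)                   ≡⟨ cong (slice S (suc (suc u))) length-split ⟩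
      slice S (suc (suc u)) (r + suc (suc u))         ≡⟨ slice-++ S (suc (suc u)) r (suc (suc u)) ⟩
      R ++ slice S (suc (suc u) + r) (suc (suc u))    ≡⟨ cong (λ z → R ++ slice S z (suc (suc u))) end-of-R ⟩
      R ++ S (suc k) ∷ slice S (suc (suc k)) (suc u)  ≡⟨ cong₂ (λ a b → R ++ a ∷ b) Sm (slice-period (suc u)) ⟩
      R ++ n ∷ map (n +_) (slice S 1 (suc u))         ≡⟨ cong (λ z → R ++ n ∷ map (n +_) z) (sym (slice-snoc S 1 u)) ⟩
      R ++ n ∷ map (n +_) (slice S 1 u ++ S (suc u) ∷ []) ∎

  -- Grouping all touching paths by the row of their last touch.
  touches : ∀ r u → u + r ≡ k →
    Σ< (suc n) (λ t → touchSum t (slice S 1 u) (slice S (suc u) r) (suc n)) ≡ Σ< r (λ v → rotated (suc (u + v)))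
  touches zero    u eq = Σ-zero (suc n)
  touches (suc r) u eq = begin
    Σ< (suc n) (λ t → touchTerm t (slice S 1 u) (S (suc u)) R (suc n) + touchSum t (slice S 1 u ++ S (suc u) ∷ []) R (suc n))
      ≡⟨ Σ-+ (suc n) _ _ ⟩
    Σ< (suc n) (λ t → touchTerm t (slice S 1 u) (S (suc u)) R (suc n))
      + Σ< (suc n) (λ t → touchSum t (slice S 1 u ++ S (suc u) ∷ []) R (suc n))
      ≡⟨ cong₂ _+_ (lastTouchRow u r eq)
                   (trans (cong (λ z → Σ< (suc n) (λ t → touchSum t z R (suc n))) (slice-snoc S 1 u))
                          (touches r (suc u) (trans (sym (+-suc u r)) eq))) ⟩
    rotated (suc u) + Σ< r (λ v → rotated (suc (suc u + v)))
      ≡⟨ cong₂ _+_ (cong (λ z → rotated (suc z)) (sym (+-identityʳ u)))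
                   (Σ-ext r (λ v → cong (λ z → rotated (suc z)) (sym (+-suc u v)))) ⟩
    rotated (suc (u + 0)) + Σ< r (λ v → rotated (suc (u + suc v)))
      ≡⟨ sym (Σ-head r (λ v → rotated (suc (u + v)))) ⟩
    Σ< (suc r) (λ v → rotated (suc (u + v))) ∎
    where R = slice S (suc (suc u)) r

  cyclicSum : Σ< (suc k) (λ u → rotated (suc u)) ≡ (suc n + k) C k
  cyclicSum = begin
    Σ< k (λ u → rotated (suc u)) + rotated (suc k)
      ≡⟨ +-comm (Σ< k (λ u → rotated (suc u))) _ ⟩
    rotated (suc k) + Σ< k (λ u → rotated (suc u))
      ≡⟨ cong₂ _+_ (sym untouched) (sym (touches k 0 refl)) ⟩
    Above 0 (map suc L) (suc n) + Σ< (suc n) (λ t → touchSum t [] L (suc n))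
      ≡⟨ sym (strip-touches n) ⟩
    Above n L (suc n)
      ≡⟨ sym free-count ⟩
    (suc n + k) C k ∎

module _ {A : Set} {P : Pred A 0ℓ} (P? : Decidable P) where

  length-filter-map : ∀ (g : A → A) xs → length (filter P? (map g xs)) ≡ length (filter (λ s → P? (g s)) xs)
  length-filter-map g []       = refl
  length-filter-map g (x ∷ xs) with does (P? (g x))
  ... | true  = cong suc (length-filter-map g xs)
  ... | false = length-filter-map g xs

  length-filter-none : ∀ xs → (∀ s → ¬ P s) → length (filter P? xs) ≡ 0
  length-filter-none xs none = cong length (filter-none P? (universal none xs))

  length-filter-single : ∀ s → P s → length (filter P? (s ∷ [])) ≡ 1
  length-filter-single s p = cong length (filter-accept P? p)

length-filter-⇔ : ∀ {A : Set} {P P' : Pred A 0ℓ} (P? : Decidable P) (P'? : Decidable P') xs →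
  (∀ s → P s → P' s) → (∀ s → P' s → P s) → length (filter P? xs) ≡ length (filter P'? xs)
length-filter-⇔ P? P'? xs to from = cong length (filter-≐ P? P'? ((λ {s} → to s) , (λ {s} → from s)) xs)

-- D as a count of paths above a list of bounds

module Domination (k : ℕ) (b : Vec ℕ (suc k)) where

  dominatedFrom : Point → ℕ → ℕ → ℕ
  dominatedFrom p e h = length (filter (λ s → all? (dominated? b) (pointsFrom p s)) (paths e h))

  dominated-start : ∀ p s → All (Dominated b) (pointsFrom p s) → Dominated b p
  dominated-start (x , y) []      (d ∷ _) = d
  dominated-start (x , y) (E ∷ s) (d ∷ _) = d
  dominated-start (x , y) (N ∷ s) (d ∷ _) = d

  east-first : ∀ e h x y → Dominated b (x , y) →
    length (filter (λ s → all? (dominated? b) (pointsFrom (x , y) s)) (map (E ∷_) (paths e h))) ≡ dominatedFrom (suc x , y) e h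
  east-first e h x y d = trans (length-filter-map (λ s → all? (dominated? b) (pointsFrom (x , y) s)) (E ∷_) (paths e h))
    (length-filter-⇔ _ _ (paths e h) (λ { s (_ ∷ ds) → ds }) (λ s ds → d ∷ ds))

  north-first : ∀ e h x y → Dominated b (x , y) →
    (f b (suc y) ≤ x → dominatedFrom (x , suc y) e h ≡ Above x (slice (f b) (suc (suc y)) h) e) →
    length (filter (λ s → all? (dominated? b) (pointsFrom (x , y) s)) (map (N ∷_) (paths e h)))
      ≡ ι (f b (suc y)) x * Above x (slice (f b) (suc (suc y)) h) e
  north-first e h x y d above = trans (length-filter-map (λ s → all? (dominated? b) (pointsFrom (x , y) s)) (N ∷_) (paths e h))
    (trans (length-filter-⇔ _ (λ s → all? (dominated? b) (pointsFrom (x , suc y) s)) (paths e h)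
                            (λ { s (_ ∷ ds) → ds }) (λ s ds → d ∷ ds))
           continue)
    where
    continue : dominatedFrom (x , suc y) e h ≡ ι (f b (suc y)) x * Above x (slice (f b) (suc (suc y)) h) e
    continue with f b (suc y) ≤? x
    ... | yes q = trans (above q) (sym (trans (cong (_* Above x (slice (f b) (suc (suc y)) h) e) (ι-yes q)) (*-identityˡ _)))
    ... | no ¬q = trans (length-filter-none _ (paths e h) (λ s ds → ¬q (proj₂ (dominated-start (x , suc y) s ds))))
                        (sym (cong (_* Above x (slice (f b) (suc (suc y)) h) e) (ι-no (≰⇒> ¬q))))

  dominatedFrom≡Above : ∀ e h x y → y + h ≤ suc k → f b y ≤ x → dominatedFrom (x , y) e h ≡ Above x (slice (f b) (suc y) h) e
  dominatedFrom≡Above zero zero x y p q =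
    length-filter-single (λ s → all? (dominated? b) (pointsFrom (x , y) s)) [] ((≤-trans (m≤m+n y 0) p , q) ∷ [])
  dominatedFrom≡Above zero (suc h) x y p q = north-first zero h x y (≤-trans (m≤m+n y (suc h)) p , q)
    (dominatedFrom≡Above zero h x (suc y) (subst (_≤ suc k) (+-suc y h) p))
  dominatedFrom≡Above (suc e) zero x y p q = trans (east-first e zero x y (≤-trans (m≤m+n y 0) p , q))
    (dominatedFrom≡Above e zero (suc x) y p (m≤n⇒m≤1+n q))
  dominatedFrom≡Above (suc e) (suc h) x y p q = begin
    length (filter P? (map (E ∷_) (paths e (suc h)) ++ map (N ∷_) (paths (suc e) h)))
      ≡⟨ cong length (filter-++ P? (map (E ∷_) (paths e (suc h))) (map (N ∷_) (paths (suc e) h))) ⟩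
    length (filter P? (map (E ∷_) (paths e (suc h))) ++ filter P? (map (N ∷_) (paths (suc e) h)))
      ≡⟨ length-++ (filter P? (map (E ∷_) (paths e (suc h)))) ⟩
    length (filter P? (map (E ∷_) (paths e (suc h)))) + length (filter P? (map (N ∷_) (paths (suc e) h)))
      ≡⟨ cong₂ _+_ (trans (east-first e (suc h) x y d) (dominatedFrom≡Above e (suc h) (suc x) y p (m≤n⇒m≤1+n q)))
                   (north-first (suc e) h x y d (dominatedFrom≡Above (suc e) h x (suc y) (subst (_≤ suc k) (+-suc y h) p))) ⟩
    Above x (slice (f b) (suc y) (suc h)) (suc e) ∎
    where P? = λ s → all? (dominated? b) (pointsFrom (x , y) s)
          d : Dominated b (x , y)
          d = ≤-trans (m≤m+n y (suc h)) p , q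

  D≡Above : ∀ n → f b 0 ≡ 0 → D n b ≡ Above 0 (slice (f b) 1 (suc k)) n
  D≡Above n f0 = dominatedFrom≡Above n (suc k) 0 0 ≤-refl (≤-reflexive f0)

segment-below : ∀ k y → y < suc k → segment k y ≡ y
segment-below k y p with y <? suc k
... | yes _ = refl
... | no ¬p = ⊥-elim (¬p p)

segment-top : ∀ k → segment k (suc k) ≡ k
segment-top k with suc k <? suc k
... | yes q = ⊥-elim (<-irrefl refl q)
... | no  _ = refl

f-at-integer : ∀ k (b : Vec ℕ (suc k)) y → y ≤ suc k → f b y ≡ Σ< y (entry b)
f-at-integer k b y p with m≤n⇒m<n∨m≡n p
... | inj₁ y<m = begin
  entry b (segment k y) * (y ∸ segment k y) + prefix b (segment k y)
    ≡⟨ cong (λ z → entry b z * (y ∸ z) + prefix b z) (segment-below k y y<m) ⟩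
  entry b y * (y ∸ y) + prefix b y ≡⟨ cong (λ z → entry b y * z + prefix b y) (n∸n≡0 y) ⟩
  entry b y * 0 + prefix b y       ≡⟨ cong (_+ prefix b y) (*-zeroʳ (entry b y)) ⟩
  prefix b y                       ≡⟨ sum-upTo≡Σ (entry b) y ⟩
  Σ< y (entry b)                   ∎
... | inj₂ refl = begin
  entry b (segment k (suc k)) * (suc k ∸ segment k (suc k)) + prefix b (segment k (suc k))
    ≡⟨ cong (λ z → entry b z * (suc k ∸ z) + prefix b z) (segment-top k) ⟩
  entry b k * (suc k ∸ k) + prefix b k ≡⟨ cong (λ z → entry b k * z + prefix b k) (m+n∸n≡m 1 k) ⟩
  entry b k * 1 + prefix b k          ≡⟨ cong₂ _+_ (*-identityʳ (entry b k)) (sum-upTo≡Σ (entry b) k) ⟩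
  entry b k + Σ< k (entry b)          ≡⟨ +-comm (entry b k) _ ⟩
  Σ< (suc k) (entry b)                ∎

toℕ-mod : ∀ k i → i < suc k → toℕ (i mod suc k) ≡ i
toℕ-mod k i p = trans (toℕ-fromℕ< _) (m≤n⇒m%n≡m (≤-pred p))

entry-toℕ : ∀ k (a : Vec ℕ (suc k)) (i : Fin (suc k)) → entry a (toℕ i) ≡ lookup a i
entry-toℕ k a i = cong (lookup a) (toℕ-injective (toℕ-mod k (toℕ i) (toℕ<n i)))

entry-shift : ∀ k j (a : Vec ℕ (suc k)) i → i < suc k → entry (shift j a) i ≡ entry a (i + (suc k ∸ j))
entry-shift k j a i p = trans (lookup∘tabulate (λ i' → entry a (toℕ i' + (suc k ∸ j))) (i mod suc k))
  (cong (λ z → entry a (z + (suc k ∸ j))) (toℕ-mod k i p))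

entry-periodic : ∀ k (a : Vec ℕ (suc k)) i → entry a (suc k + i) ≡ entry a i
entry-periodic k a i = cong (lookup a) (toℕ-injective (begin
  toℕ ((suc k + i) mod suc k) ≡⟨ toℕ-fromℕ< _ ⟩
  (suc k + i) % suc k         ≡⟨ cong (_% suc k) (+-comm (suc k) i) ⟩
  (i + suc k) % suc k         ≡⟨ [m+n]%n≡m%n i (suc k) ⟩
  i % suc k                   ≡⟨ sym (toℕ-fromℕ< _) ⟩
  toℕ (i mod suc k)           ∎))

Vec-sum≡Σ : ∀ {M} (v : Vec ℕ M) (g : ℕ → ℕ) → (∀ (i : Fin M) → g (toℕ i) ≡ lookup v i) → Vec.sum v ≡ Σ< M g
Vec-sum≡Σ Vec.[]             g eq = refl
Vec-sum≡Σ {suc M} (x Vec.∷ v) g eq = begin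
  x + Vec.sum v                   ≡⟨ cong₂ _+_ (sym (eq Fin.zero)) (Vec-sum≡Σ v (λ i → g (suc i)) (λ i → eq (Fin.suc i))) ⟩
  g 0 + Σ< M (λ i → g (suc i))    ≡⟨ sym (Σ-head M g) ⟩
  Σ< (suc M) g                    ∎

module Composition (k n : ℕ) (a : Vec ℕ (suc k)) (sum-a : Vec.sum a ≡ n) where

  S : ℕ → ℕ
  S y = Σ< y (entry a)

  S-total : S (suc k) ≡ n
  S-total = trans (sym (Vec-sum≡Σ a (entry a) (entry-toℕ k a))) sum-a

  S-periodic : ∀ y → S (suc k + y) ≡ n + S y
  S-periodic y = trans (Σ-split (suc k) y (entry a)) (cong₂ _+_ S-total (Σ-ext y (entry-periodic k a)))

  open CyclicSum S n k (λ y → m≤m+n (S y) (entry a y)) S-total S-periodic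

  D-shift : ∀ j → j < suc k → D n (shift j a) ≡ rotated (suc k ∸ j)
  D-shift j j<m = begin
    D n b                                  ≡⟨ Domination.D≡Above k b n (f-at-integer k b 0 z≤n) ⟩
    Above 0 (slice (f b) 1 (suc k)) n
      ≡⟨ cong (λ z → Above 0 z n) (slice-cong (suc k) (f b) Sb 1 1 (λ i p → f-at-integer k b (suc i) p)) ⟩
    Above 0 (slice Sb 1 (suc k)) n         ≡⟨ sym (Above-translate (S u) 0 (slice Sb 1 (suc k)) n) ⟩
    Above (S u + 0) (map (S u +_) (slice Sb 1 (suc k))) n
      ≡⟨ cong₂ (λ x L → Above x L n) (+-identityʳ (S u))
           (trans (map-slice (S u +_) Sb 1 (suc k)) (slice-cong (suc k) (λ z → S u + Sb z) S 1 (suc u) shifted-sums)) ⟩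
    rotated u                              ∎
    where
    b = shift j a
    u = suc k ∸ j
    Sb : ℕ → ℕ
    Sb y = Σ< y (entry b)
    -- the partial sums of a^j are differences of partial sums of a
    shifted-sums : ∀ i → i < suc k → S u + Sb (1 + i) ≡ S (suc u + i)
    shifted-sums i p = begin
      S u + Sb (suc i)
        ≡⟨ cong (S u +_) (Σ-cong (suc i) (λ t q → trans (entry-shift k j a t (<-≤-trans q p)) (cong (entry a) (+-comm t u)))) ⟩
      S u + Σ< (suc i) (λ t → entry a (u + t)) ≡⟨ sym (Σ-split u (suc i) (entry a)) ⟩
      S (u + suc i)                            ≡⟨ cong S (+-suc u i) ⟩
      S (suc u + i)                            ∎

  cyclic-sum-of-D : Σ< (suc k) (λ j → D n (shift j a)) ≡ (suc n + k) C k
  cyclic-sum-of-D = begin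
    Σ< (suc k) (λ j → D n (shift j a))     ≡⟨ Σ-cong (suc k) D-shift ⟩
    Σ< (suc k) (λ j → rotated (suc k ∸ j)) ≡⟨ Σ-reverse (suc k) rotated ⟩
    Σ< (suc k) (λ u → rotated (suc u))     ≡⟨ cyclicSum ⟩
    (suc n + k) C k                        ∎

corollary1 : (k n : ℕ) (a : Vec ℕ (suc k)) → Vec.sum a ≡ n →
    sum (map (λ j → D n (shift j a)) (upTo (suc k))) ≡ (n + suc k) C k
corollary1 k n a sum-a = begin
  sum (map (λ j → D n (shift j a)) (upTo (suc k))) ≡⟨ sum-upTo≡Σ (λ j → D n (shift j a)) (suc k) ⟩
  Σ< (suc k) (λ j → D n (shift j a))               ≡⟨ Composition.cyclic-sum-of-D k n a sum-a ⟩
  (suc n + k) C k                                  ≡⟨ cong (_C k) (sym (+-suc n k)) ⟩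
  (n + suc k) C k                                  ∎
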